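{- Let $a$ and $b$ be positive integers and define $p_{a,b}\colon\mathbb{N}^2\to\mathbb{N}$ by \[ p_{a,b}(x,y)=\begin{cases} y\bigl\lfloor\sqrt[b]{y}\,\bigr\rfloor^a+x &\text{if } \bigl\lfloor\sqrt[b]{y}\,\bigr\rfloor>\bigl\lfloor\sqrt[a]{x}\,\bigr\rfloor,\\ x\Bigl(\bigl\lfloor\sqrt[a]{x}\,\bigr\rfloor+1\Bigr)^{b}+y &\text{otherwise}. \end{cases} \] Then $s(x,y)=\max\bigl(\lfloor\sqrt[a]{x}\rfloor,\lfloor\sqrt[b]{y}\rfloor\bigr)$ is a shell numbering for $p_{a,b}$: for all $(x_1,y_1),(x_2,y_2)\in\mathbb{N}^2$, $s(x_1,y_1)<s(x_2,y_2)$ implies $p_{a,b}(x_1,y_1)<p_{a,b}(x_2,y_2)$.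
   Context: $\mathbb{N}$ denotes the set of non-negative integers. -}

module Defs where

open import Data.Nat using (ℕ; zero; suc; _+_; _*_; _^_; _≤?_; _<ᵇ_; _⊔_)
open import Data.Bool using (if_then_else_)
open import Relation.Nullary.Decidable using (does)

rootSearch : ℕ → ℕ → ℕ → ℕ
rootSearch k x zero    = zero
rootSearch k x (suc c) = if does (suc c ^ k ≤? x) then suc c else rootSearch k x c

-- ⌊ x ^ (1/k) ⌋ for k ≥ 1: the largest r with r ^ k ≤ x.
-- (For k ≥ 1 any such r satisfies r ≤ x, so searching r ∈ {0..x} suffices.)
iroot : ℕ → ℕ → ℕ
iroot k x = rootSearch k x x

p : ℕ → ℕ → ℕ → ℕ → ℕ
p a b x y =
  if iroot a x <ᵇ iroot b y
  then y * (iroot b y) ^ a + x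
  else x * (suc (iroot a x)) ^ b + y

s : ℕ → ℕ → ℕ → ℕ → ℕ
s a b x y = iroot a x ⊔ iroot b y

module Submission where

-- Write m = s(x,y).  The pairing value p(x,y) lies in the
-- "shell block" [m^a·m^b, (m+1)^a·(m+1)^b).  Since blocks are monotone in m,
-- a point in a lower shell lies in a lower block, which is the theorem:
--   p(x₁,y₁) < (s₁+1)^a·(s₁+1)^b ≤ s₂^a·s₂^b ≤ p(x₂,y₂)   when s₁ < s₂.

open import Defs
open import Data.Nat using (ℕ; _<_; NonZero)
open import Data.Nat.Base
open import Data.Nat.Properties
open import Data.Bool using (true; false; if_then_else_)
open import Data.Product using (_×_; _,_; proj₁; proj₂)
open import Relation.Nullary.Reflects using (ofʸ; ofⁿ)
open import Relation.Binary.PropositionalEquality using (sym)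

IsFloorRoot : ℕ → ℕ → ℕ → Set
IsFloorRoot k x r = r ^ k ≤ x × x < suc r ^ k

n≤n^k : ∀ n k .{{_ : NonZero k}} → n ≤ n ^ k
n≤n^k zero    k = z≤n
n≤n^k (suc n) k = begin
  suc n         ≡⟨ sym (^-identityʳ (suc n)) ⟩
  suc n ^ 1     ≤⟨ ^-monoʳ-≤ (suc n) (>-nonZero⁻¹ k) ⟩
  suc n ^ k     ∎
  where open ≤-Reasoning

rootSearch-lower : ∀ k .{{_ : NonZero k}} x c → rootSearch k x c ^ k ≤ x
rootSearch-lower (suc k) x zero = z≤n
rootSearch-lower k x (suc c) with suc c ^ k ≤ᵇ x | ≤ᵇ-reflects-≤ (suc c ^ k) x
... | true  | ofʸ fits = fits
... | false | ofⁿ _    = rootSearch-lower k x c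

rootSearch-upper : ∀ k x c → x < suc c ^ k → x < suc (rootSearch k x c) ^ k
rootSearch-upper k x zero    x<1 = x<1
rootSearch-upper k x (suc c) x<c+2 with suc c ^ k ≤ᵇ x | ≤ᵇ-reflects-≤ (suc c ^ k) x
... | true  | ofʸ _       = x<c+2
... | false | ofⁿ too-big = rootSearch-upper k x c (≰⇒> too-big)

-- Specification of the integer root from Defs: searching from c = x works
-- because (x+1)^k > x for k ≥ 1.
iroot-isFloorRoot : ∀ k .{{_ : NonZero k}} x → IsFloorRoot k x (iroot k x)
iroot-isFloorRoot k x =
  rootSearch-lower k x x ,
  rootSearch-upper k x x (<-≤-trans (n<1+n x) (n≤n^k (suc x) k))

mixedRadix-< : ∀ {q d Q B} → d < B → q < Q → q * B + d < Q * B
mixedRadix-< {q} {d} {Q} {B} d<B q<Q = begin-strict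
  q * B + d   <⟨ +-monoʳ-< (q * B) d<B ⟩
  q * B + B   ≡⟨ +-comm (q * B) B ⟩
  suc q * B   ≤⟨ *-monoˡ-≤ B q<Q ⟩
  Q * B       ∎
  where open ≤-Reasoning

blockStart : ℕ → ℕ → ℕ → ℕ
blockStart a b m = m ^ a * m ^ b

blockStart-mono : ∀ a b {m n} → m ≤ n → blockStart a b m ≤ blockStart a b n
blockStart-mono a b m≤n = *-mono-≤ (^-monoˡ-≤ a m≤n) (^-monoˡ-≤ b m≤n)

InBlock : ℕ → ℕ → ℕ → ℕ → Set
InBlock a b m n = blockStart a b m ≤ n × n < blockStart a b (suc m)

-- p with the two roots u = ⌊x^{1/a}⌋, v = ⌊y^{1/b}⌋ abstracted;
-- p a b x y is definitionally  pairingWith a b x y (iroot a x) (iroot b y).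
pairingWith : ℕ → ℕ → ℕ → ℕ → ℕ → ℕ → ℕ
pairingWith a b x y u v = if u <ᵇ v then y * v ^ a + x else x * suc u ^ b + y

-- Branch u < v: the value y·v^a + x lies in the block of shell v
-- (y is the leading digit in [v^b, (v+1)^b), x a digit below (u+1)^a ≤ v^a).
yBranch-inBlock : ∀ a b {x y u v} → IsFloorRoot a x u → IsFloorRoot b y v →
  u < v → InBlock a b v (y * v ^ a + x)
yBranch-inBlock a b {x} {y} {u} {v} (_ , x<u+1) (v≤y , y<v+1) u<v =
  lower , upper
  where
  open ≤-Reasoning
  lower : blockStart a b v ≤ y * v ^ a + x
  lower = begin
    v ^ a * v ^ b   ≡⟨ *-comm (v ^ a) (v ^ b) ⟩
    v ^ b * v ^ a   ≤⟨ *-monoˡ-≤ (v ^ a) v≤y ⟩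
    y * v ^ a       ≤⟨ m≤m+n (y * v ^ a) x ⟩
    y * v ^ a + x   ∎
  upper : y * v ^ a + x < blockStart a b (suc v)
  upper = begin-strict
    y * v ^ a + x               <⟨ mixedRadix-< (<-≤-trans x<u+1 (^-monoˡ-≤ a u<v)) y<v+1 ⟩
    suc v ^ b * v ^ a           ≤⟨ *-monoʳ-≤ (suc v ^ b) (^-monoˡ-≤ a (n≤1+n v)) ⟩
    suc v ^ b * suc v ^ a       ≡⟨ *-comm (suc v ^ b) (suc v ^ a) ⟩
    suc v ^ a * suc v ^ b       ∎

-- Branch v ≤ u: the value x·(u+1)^b + y lies in the block of shell u
-- (x is the leading digit in [u^a, (u+1)^a), y a digit below (v+1)^b ≤ (u+1)^b).
xBranch-inBlock : ∀ a b {x y u v} → IsFloorRoot a x u → IsFloorRoot b y v →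
  v ≤ u → InBlock a b u (x * suc u ^ b + y)
xBranch-inBlock a b {x} {y} {u} {v} (u≤x , x<u+1) (_ , y<v+1) v≤u =
  lower , mixedRadix-< (<-≤-trans y<v+1 (^-monoˡ-≤ b (s≤s v≤u))) x<u+1
  where
  open ≤-Reasoning
  lower : blockStart a b u ≤ x * suc u ^ b + y
  lower = begin
    u ^ a * u ^ b           ≤⟨ *-mono-≤ u≤x (^-monoˡ-≤ b (n≤1+n u)) ⟩
    x * suc u ^ b           ≤⟨ m≤m+n (x * suc u ^ b) y ⟩
    x * suc u ^ b + y       ∎

pairingWith-inBlock : ∀ a b {x y u v} → IsFloorRoot a x u → IsFloorRoot b y v →
  InBlock a b (u ⊔ v) (pairingWith a b x y u v)
pairingWith-inBlock a b {x} {y} {u} {v} rootX rootY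
  with u <ᵇ v | <ᵇ-reflects-< u v
... | true  | ofʸ u<v rewrite m≤n⇒m⊔n≡n (<⇒≤ u<v) =
  yBranch-inBlock a b rootX rootY u<v
... | false | ofⁿ u≮v rewrite m≥n⇒m⊔n≡m (≮⇒≥ u≮v) =
  xBranch-inBlock a b rootX rootY (≮⇒≥ u≮v)

p-inBlock : ∀ a b .{{_ : NonZero a}} .{{_ : NonZero b}} x y →
  InBlock a b (s a b x y) (p a b x y)
p-inBlock a b x y =
  pairingWith-inBlock a b (iroot-isFloorRoot a x) (iroot-isFloorRoot b y)

theorem5p4 : (a b : ℕ) → .{{_ : NonZero a}} → .{{_ : NonZero b}} →
    (x₁ y₁ x₂ y₂ : ℕ) → s a b x₁ y₁ < s a b x₂ y₂ → p a b x₁ y₁ < p a b x₂ y₂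
theorem5p4 a b x₁ y₁ x₂ y₂ s₁<s₂ = begin-strict
  p a b x₁ y₁                          <⟨ proj₂ (p-inBlock a b x₁ y₁) ⟩
  blockStart a b (suc (s a b x₁ y₁))   ≤⟨ blockStart-mono a b s₁<s₂ ⟩
  blockStart a b (s a b x₂ y₂)         ≤⟨ proj₁ (p-inBlock a b x₂ y₂) ⟩
  p a b x₂ y₂                          ∎
  where open ≤-Reasoning
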